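{- Let $t\geq 1$ and $N\geq 2t+1$ be integers, and let $G$ be a graph without isolated vertices with $e(G)=N$ and $\Delta(G)=N-t$ (so $\Delta(G)>\frac N2$) such that $e(L(G))=f(N,N-t)$. Then \[f(N,N-t)=\binom{N-t}{2}+\binom{t+2}{2}-1,\] and $G$ is one of the following: (1) the graph $Q(N,t)$: it contains two adjacent vertices $u,v$ with $\deg(u)=N-t$ and $\deg(v)=t+1$, such that all $t$ neighbours of $v$ other than $u$ are also neighbours of $u$ (so the edges of $G$ are the $N-t$ edges at $u$ together with the $t$ edges from $v$ to other neighbours of $u$); (2) only when $t=3$, alternatively the graph $Q^*(N,3)$: it contains a vertex $u$ of degree $N-3$ and three neighbours $v,x,y$ of $u$ which form a triangle, and these are all the edges of $G$.
   Context: All graphs are finite and simple; $L(G)$ is the line graph, so $e(L(G))=\sum_v\binom{\deg(v)}{2}$. For integers $N\ge\Delta\ge1$, $f(N,\Delta)=\max\{e(L(G)) : e(G)=N,\ \Delta(G)=\Delta,\ \delta(G)\geq1\}$. -}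

module Defs where

open import Data.Nat using (ℕ; zero; suc; _+_; _*_; _∸_; _≤_; _<ᵇ_)
open import Data.Nat.Combinatorics using (_C_)
open import Data.Bool using (Bool; true; false; if_then_else_; _∧_)
open import Data.Fin using (Fin; toℕ)
open import Data.List using (List; map; allFin)
open import Data.Nat.ListAction using (sum)
open import Data.Sum using () renaming (_⊎_ to _⊎'_)
open import Data.Product using (Σ; ∃; _×_)
open import Relation.Binary.PropositionalEquality using (_≡_)

record Graph (n : ℕ) : Set where
  field
    adj   : Fin n → Fin n → Bool
    sym   : ∀ i j → adj i j ≡ adj j i
    irref : ∀ i → adj i i ≡ false
open Graph public

count : ∀ {n} → (Fin n → Bool) → ℕ
count {n} p = sum (map (λ i → if p i then 1 else 0) (allFin n))

deg : ∀ {n} → Graph n → Fin n → ℕ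
deg G v = count (adj G v)

edges : ∀ {n} → Graph n → ℕ
edges {n} G = sum (map (λ i → count (λ j → adj G i j ∧ (toℕ i <ᵇ toℕ j))) (allFin n))

-- e(L(G)) = Σ_v C(deg v, 2)
lineEdges : ∀ {n} → Graph n → ℕ
lineEdges {n} G = sum (map (λ v → deg G v C 2) (allFin n))

MaxDeg : ∀ {n} → Graph n → ℕ → Set
MaxDeg G D = (∀ v → deg G v ≤ D) × (∃ λ v → deg G v ≡ D)

NoIsolated : ∀ {n} → Graph n → Set
NoIsolated G = ∀ v → 1 ≤ deg G v

Admissible : ∀ {n} → Graph n → ℕ → ℕ → Set
Admissible G N D = (edges G ≡ N) × MaxDeg G D × NoIsolated G

-- e(L(G)) = f(N,Δ): G is admissible and attains the maximum of e(L(H))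
-- over all admissible H (on any number of vertices).
Extremal : ∀ {n} → Graph n → ℕ → ℕ → Set
Extremal G N D = Admissible G N D ×
  (∀ (m : ℕ) (H : Graph m) → Admissible H N D → lineEdges H ≤ lineEdges G)

-- f(N,D) = c : c is the maximum of e(L(H)) over admissible H (attained)
FValue : ℕ → ℕ → ℕ → Set
FValue N D c = (Σ ℕ λ m → Σ (Graph m) λ H → Admissible H N D × lineEdges H ≡ c) ×
  (∀ (m : ℕ) (H : Graph m) → Admissible H N D → lineEdges H ≤ c)

IsQ : ∀ {n} → Graph n → ℕ → ℕ → Set
IsQ {n} G N t = Σ (Fin n) λ u → Σ (Fin n) λ v →
  (adj G u v ≡ true) × (deg G u ≡ N ∸ t) × (deg G v ≡ t + 1) ×
  (∀ w → adj G v w ≡ true → w ≡ u ⊎' adj G u w ≡ true) ×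
  (∀ a b → adj G a b ≡ true → (a ≡ u ⊎' b ≡ u) ⊎' (a ≡ v ⊎' b ≡ v))

IsQstar : ∀ {n} → Graph n → ℕ → Set
IsQstar {n} G N = Σ (Fin n) λ u → Σ (Fin n) λ v → Σ (Fin n) λ x → Σ (Fin n) λ y →
  (deg G u ≡ N ∸ 3) ×
  (adj G u v ≡ true) × (adj G u x ≡ true) × (adj G u y ≡ true) ×
  (adj G v x ≡ true) × (adj G x y ≡ true) × (adj G v y ≡ true) ×
  (∀ a b → adj G a b ≡ true →
     (a ≡ u ⊎' b ≡ u) ⊎'
     ((a ≡ v ⊎' a ≡ x ⊎' a ≡ y) × (b ≡ v ⊎' b ≡ x ⊎' b ≡ y)))

{-# OPTIONS --safe #-}

-- Fix a vertex u of maximum degree D = N − t and let H = G ⊖ u be G with the edges at u deleted, so H has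
-- t edges. Writing h for degrees in H, e(L(G)) = C(D,2) + Σ_w C(h w, 2) + Σ_{w ~ u} h w, and the last sum is
-- at most Σ_w h w = 2t. Every edge wx of H has h w + h x ≤ t + 1, so double counting gives
-- Σ_w (h w)² = Σ_{wx ∈ E(H)} (h w + h x) ≤ t (t + 1), i.e. Σ_w C(h w, 2) ≤ C(t, 2). Hence
-- e(L(G)) ≤ C(D,2) + C(t,2) + 2t, and Q(N,t) attains this. In the equality case every non-isolated vertex of H
-- is adjacent to u and every edge wx of H has h w + h x = t + 1, which makes wx meet every edge of H. Such an H
-- is either a star K_{1,t}, giving Q(N,t), or a triangle, which forces t = 3 and gives Q*(N,3).

module Submission where

open import Defs renaming (sym to adj-sym; irref to adj-irrefl)
open import Data.Bool using (Bool; true; false; if_then_else_; _∧_; not)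
open import Data.Empty using (⊥-elim)
open import Data.Fin using (Fin; zero; suc; toℕ)
open import Data.Fin.Properties using (_≟_) renaming (suc-injective to Fin-suc-injective)
open import Data.List using (map; allFin; tabulate)
open import Data.List.Properties using (map-tabulate)
import Data.Nat.ListAction as List
open import Data.Nat using (ℕ; zero; suc; _+_; _∸_; _*_; _≤_; _<_; z≤n; s≤s; _<ᵇ_; _≤?_)
open import Data.Nat.Properties hiding (_≟_)
open import Data.Nat.Properties using () renaming (_≟_ to _≟ℕ_)
open import Data.Nat.Combinatorics using (_C_; nCk+nC[k+1]≡[n+1]C[k+1]; nC1≡n)
open import Data.Nat.Tactic.RingSolver using (solve-∀)
open import Data.Product using (Σ; ∃; _×_; _,_; proj₁; proj₂)
open import Data.Sum using (_⊎_; inj₁; inj₂; map₂)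
open import Relation.Nullary using (Dec; yes; no; does)
open import Relation.Binary.PropositionalEquality
open import Algebra.Properties.Semiring.Sum +-*-semiring
  using (sum; sum-syntax; sum-cong-≗; ∑-distrib-+; ∑-comm; *-distribʳ-sum; sum-replicate-zero)

𝟙 : Bool → ℕ
𝟙 b = if b then 1 else 0

𝟙≤1 : ∀ b → 𝟙 b ≤ 1
𝟙≤1 true  = ≤-refl
𝟙≤1 false = z≤n

𝟙-pos : ∀ {b} → 1 ≤ 𝟙 b → b ≡ true
𝟙-pos {true}  _ = refl

𝟙*≤ : ∀ b k → 𝟙 b * k ≤ k
𝟙*≤ true  k = ≤-reflexive (+-identityʳ k)
𝟙*≤ false k = z≤n

𝟙*-fixed : ∀ {b k} → 1 ≤ k → 𝟙 b * k ≡ k → b ≡ true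
𝟙*-fixed {true}  _   _  = refl
𝟙*-fixed {false} 1≤k 0≡k = ⊥-elim (<⇒≢ 1≤k 0≡k)

sum-tabulate : ∀ {n} (f : Fin n → ℕ) → List.sum (tabulate f) ≡ sum f
sum-tabulate {zero}  f = refl
sum-tabulate {suc n} f = cong (f zero +_) (sum-tabulate (λ i → f (suc i)))

sum-allFin : ∀ {n} (f : Fin n → ℕ) → List.sum (map f (allFin n)) ≡ sum f
sum-allFin f = trans (cong List.sum (map-tabulate (λ i → i) f)) (sum-tabulate f)

sum-zero : ∀ {n} → ∑[ i < n ] 0 ≡ 0
sum-zero {n} = sum-replicate-zero n

sum-mono-≤ : ∀ {n} {f g : Fin n → ℕ} → (∀ i → f i ≤ g i) → sum f ≤ sum g
sum-mono-≤ {zero}  f≤g = z≤n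
sum-mono-≤ {suc n} f≤g = +-mono-≤ (f≤g zero) (sum-mono-≤ (λ i → f≤g (suc i)))

+-mono-≤-≡ : ∀ {a b c d} → a ≤ c → b ≤ d → a + b ≡ c + d → a ≡ c × b ≡ d
+-mono-≤-≡ {a} {b} {c} {d} a≤c b≤d eq = a≡c , +-cancelˡ-≡ a b d (trans eq (cong (_+ d) (sym a≡c)))
  where
  a≡c : a ≡ c
  a≡c = ≤-antisym a≤c (+-cancelʳ-≤ b c a (≤-trans (+-monoʳ-≤ c b≤d) (≤-reflexive (sym eq))))

sum-mono-≤-≡ : ∀ {n} {f g : Fin n → ℕ} → (∀ i → f i ≤ g i) → sum f ≡ sum g → ∀ i → f i ≡ g i
sum-mono-≤-≡ {suc n} f≤g eq zero    = proj₁ (+-mono-≤-≡ (f≤g zero) (sum-mono-≤ (λ i → f≤g (suc i))) eq)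
sum-mono-≤-≡ {suc n} f≤g eq (suc i) =
  sum-mono-≤-≡ (λ j → f≤g (suc j)) (proj₂ (+-mono-≤-≡ (f≤g zero) (sum-mono-≤ (λ j → f≤g (suc j))) eq)) i

sum-positive : ∀ {n} (f : Fin n → ℕ) → 1 ≤ sum f → ∃ λ i → 1 ≤ f i
sum-positive {suc n} f pos with f zero in eq
... | suc _ = zero , subst (1 ≤_) (sym eq) (s≤s z≤n)
... | zero  with sum-positive (λ i → f (suc i)) pos
...   | i , fi = suc i , fi

sum-δ : ∀ {n} (i : Fin n) (f : Fin n → ℕ) → ∑[ j < n ] (𝟙 (does (i ≟ j)) * f j) ≡ f i
sum-δ {suc n} zero    f = trans (cong (f zero + 0 +_) (sum-zero {n})) (trans (+-identityʳ _) (+-identityʳ _))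
sum-δ {suc n} (suc i) f = sum-δ i (λ j → f (suc j))

sum-update : ∀ {n} (u : Fin n) {f g : Fin n → ℕ} → (∀ {w} → u ≢ w → f w ≡ g w) → sum f + g u ≡ sum g + f u
sum-update {suc n} zero    {f} {g} f≗g = begin
  f zero + sum (λ i → f (suc i)) + g zero  ≡⟨ cong (λ s → f zero + s + g zero) (sum-cong-≗ (λ i → f≗g {suc i} λ ())) ⟩
  f zero + sum (λ i → g (suc i)) + g zero  ≡⟨ arith (f zero) (sum (λ i → g (suc i))) (g zero) ⟩
  g zero + sum (λ i → g (suc i)) + f zero  ∎
  where
  open ≡-Reasoning
  arith : ∀ a s b → a + s + b ≡ b + s + a
  arith = solve-∀
sum-update {suc n} (suc u) {f} {g} f≗g = begin
  f zero + sum (λ i → f (suc i)) + g (suc u)    ≡⟨ +-assoc (f zero) _ _ ⟩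
  f zero + (sum (λ i → f (suc i)) + g (suc u))  ≡⟨ cong₂ _+_ (f≗g {zero} λ ()) (sum-update u (λ u≢w → f≗g (λ su≡sw → u≢w (Fin-suc-injective su≡sw)))) ⟩
  g zero + (sum (λ i → g (suc i)) + f (suc u))  ≡⟨ +-assoc (g zero) _ _ ⟨
  g zero + sum (λ i → g (suc i)) + f (suc u)    ∎
  where open ≡-Reasoning

card : ∀ {n} → (Fin n → Bool) → ℕ
card {n} p = ∑[ j < n ] 𝟙 (p j)

count≡card : ∀ {n} (p : Fin n → Bool) → count p ≡ card p
count≡card p = sum-allFin (λ j → 𝟙 (p j))

_∖_ : ∀ {n} → (Fin n → Bool) → Fin n → Fin n → Bool
(p ∖ a) j = not (does (a ≟ j)) ∧ p j

∖-sound : ∀ {n} {p : Fin n → Bool} {a j} → (p ∖ a) j ≡ true → p j ≡ true × a ≢ j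
∖-sound {a = a} {j} eq with a ≟ j
... | no a≢j = eq , a≢j

∖-≢ : ∀ {n} (p : Fin n → Bool) {a j} → a ≢ j → (p ∖ a) j ≡ p j
∖-≢ p {a} {j} a≢j with a ≟ j
... | yes a≡j = ⊥-elim (a≢j a≡j)
... | no _    = refl

card-∖ : ∀ {n} (p : Fin n → Bool) (a : Fin n) → card p ≡ 𝟙 (p a) + card (p ∖ a)
card-∖ {n} p a = begin
  card p                                                            ≡⟨ sum-cong-≗ split ⟩
  ∑[ j < n ] (𝟙 (does (a ≟ j)) * 𝟙 (p a) + 𝟙 ((p ∖ a) j))          ≡⟨ ∑-distrib-+ (λ j → 𝟙 (does (a ≟ j)) * 𝟙 (p a)) (λ j → 𝟙 ((p ∖ a) j)) ⟩
  ∑[ j < n ] (𝟙 (does (a ≟ j)) * 𝟙 (p a)) + card (p ∖ a)           ≡⟨ cong (_+ card (p ∖ a)) (sum-δ a (λ _ → 𝟙 (p a))) ⟩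
  𝟙 (p a) + card (p ∖ a)                                            ∎
  where
  open ≡-Reasoning
  split : ∀ j → 𝟙 (p j) ≡ 𝟙 (does (a ≟ j)) * 𝟙 (p a) + 𝟙 ((p ∖ a) j)
  split j with a ≟ j
  ... | yes refl = sym (trans (+-identityʳ _) (+-identityʳ _))
  ... | no _     = refl

card-positive : ∀ {n} (p : Fin n → Bool) → 1 ≤ card p → ∃ λ j → p j ≡ true
card-positive p pos with sum-positive (λ j → 𝟙 (p j)) pos
... | j , pj = j , 𝟙-pos pj

𝟙≤card : ∀ {n} (p : Fin n → Bool) a → 𝟙 (p a) ≤ card p
𝟙≤card p a = ≤-trans (m≤m+n _ _) (≤-reflexive (sym (card-∖ p a)))

𝟙+𝟙≤card : ∀ {n} (p : Fin n → Bool) {a b} → a ≢ b → 𝟙 (p a) + 𝟙 (p b) ≤ card p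
𝟙+𝟙≤card p {a} {b} a≢b = ≤-trans
  (+-monoʳ-≤ (𝟙 (p a)) (≤-trans (≤-reflexive (cong 𝟙 (sym (∖-≢ p a≢b)))) (𝟙≤card (p ∖ a) b)))
  (≤-reflexive (sym (card-∖ p a)))

𝟙+𝟙+𝟙≤card : ∀ {n} (p : Fin n → Bool) {a b c} → a ≢ b → a ≢ c → b ≢ c → 𝟙 (p a) + 𝟙 (p b) + 𝟙 (p c) ≤ card p
𝟙+𝟙+𝟙≤card p {a} {b} {c} a≢b a≢c b≢c = begin
  𝟙 (p a) + 𝟙 (p b) + 𝟙 (p c)              ≡⟨ +-assoc (𝟙 (p a)) _ _ ⟩
  𝟙 (p a) + (𝟙 (p b) + 𝟙 (p c))            ≡⟨ cong₂ (λ x y → 𝟙 (p a) + (𝟙 x + 𝟙 y)) (sym (∖-≢ p a≢b)) (sym (∖-≢ p a≢c)) ⟩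
  𝟙 (p a) + (𝟙 ((p ∖ a) b) + 𝟙 ((p ∖ a) c)) ≤⟨ +-monoʳ-≤ (𝟙 (p a)) (𝟙+𝟙≤card (p ∖ a) b≢c) ⟩
  𝟙 (p a) + card (p ∖ a)                    ≡⟨ sym (card-∖ p a) ⟩
  card p                                    ∎
  where open ≤-Reasoning

card-≥1 : ∀ {n} {p : Fin n → Bool} {a} → p a ≡ true → 1 ≤ card p
card-≥1 {p = p} {a} pa = ≤-trans (≤-reflexive (cong 𝟙 (sym pa))) (𝟙≤card p a)

card-≥2 : ∀ {n} {p : Fin n → Bool} {a b} → a ≢ b → p a ≡ true → p b ≡ true → 2 ≤ card p
card-≥2 {p = p} a≢b pa pb = ≤-trans (≤-reflexive (sym (cong₂ (λ x y → 𝟙 x + 𝟙 y) pa pb))) (𝟙+𝟙≤card p a≢b)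

card-≥3 : ∀ {n} {p : Fin n → Bool} {a b c} → a ≢ b → a ≢ c → b ≢ c →
          p a ≡ true → p b ≡ true → p c ≡ true → 3 ≤ card p
card-≥3 {p = p} a≢b a≢c b≢c pa pb pc =
  ≤-trans (≤-reflexive (sym (cong₂ _+_ (cong₂ (λ x y → 𝟙 x + 𝟙 y) pa pb) (cong 𝟙 pc)))) (𝟙+𝟙+𝟙≤card p a≢b a≢c b≢c)

card-≥2⇒other : ∀ {n} (p : Fin n → Bool) (a : Fin n) → 2 ≤ card p → ∃ λ j → p j ≡ true × a ≢ j
card-≥2⇒other p a two≤ with card-positive (p ∖ a)
  (+-cancelˡ-≤ 1 1 _ (≤-trans two≤ (≤-trans (≤-reflexive (card-∖ p a)) (+-monoˡ-≤ _ (𝟙≤1 (p a))))))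
... | j , pj = j , ∖-sound {p = p} {a} pj

card-≥3⇒other : ∀ {n} (p : Fin n → Bool) (a b : Fin n) → 3 ≤ card p → ∃ λ j → p j ≡ true × a ≢ j × b ≢ j
card-≥3⇒other p a b three≤ with card-≥2⇒other (p ∖ a) b
  (+-cancelˡ-≤ 1 2 _ (≤-trans three≤ (≤-trans (≤-reflexive (card-∖ p a)) (+-monoˡ-≤ _ (𝟙≤1 (p a))))))
... | j , pj , b≢j = j , proj₁ (∖-sound {p = p} {a} pj) , proj₂ (∖-sound {p = p} {a} pj) , b≢j

_≺_ : ∀ {n} → Fin n → Fin n → Bool
i ≺ j = toℕ i <ᵇ toℕ j

≺-trichotomy : ∀ {n} {i j : Fin n} → i ≢ j → 𝟙 (i ≺ j) + 𝟙 (j ≺ i) ≡ 1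
≺-trichotomy {i = zero}  {zero}  i≢j = ⊥-elim (i≢j refl)
≺-trichotomy {i = zero}  {suc j} i≢j = refl
≺-trichotomy {i = suc i} {zero}  i≢j = refl
≺-trichotomy {i = suc i} {suc j} i≢j = ≺-trichotomy (λ i≡j → i≢j (cong suc i≡j))

module _ {n : ℕ} (G : Graph n) where

  adj-flip : ∀ {i j} → adj G i j ≡ true → adj G j i ≡ true
  adj-flip {i} {j} ij = trans (adj-sym G j i) ij

  adj⇒≢ : ∀ {i j} → adj G i j ≡ true → i ≢ j
  adj⇒≢ {i} ij refl with () ← trans (sym ij) (adj-irrefl G i)

  deg≡card : ∀ v → deg G v ≡ card (adj G v)
  deg≡card v = count≡card (adj G v)

  deg-pos : ∀ {w x} → adj G w x ≡ true → 1 ≤ deg G w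
  deg-pos {w} wx = ≤-trans (card-≥1 {p = adj G w} wx) (≤-reflexive (sym (deg≡card w)))

  neighbour : ∀ {w} → 1 ≤ deg G w → ∃ λ x → adj G w x ≡ true
  neighbour {w} pos = card-positive (adj G w) (≤-trans pos (≤-reflexive (deg≡card w)))

  deg-≥2 : ∀ {w x y} → x ≢ y → adj G w x ≡ true → adj G w y ≡ true → 2 ≤ deg G w
  deg-≥2 {w} x≢y wx wy = ≤-trans (card-≥2 x≢y wx wy) (≤-reflexive (sym (deg≡card w)))

  deg-≥3 : ∀ {w x y z} → x ≢ y → x ≢ z → y ≢ z →
           adj G w x ≡ true → adj G w y ≡ true → adj G w z ≡ true → 3 ≤ deg G w
  deg-≥3 {w} x≢y x≢z y≢z wx wy wz = ≤-trans (card-≥3 x≢y x≢z y≢z wx wy wz) (≤-reflexive (sym (deg≡card w)))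

  lineEdges≡ : lineEdges G ≡ ∑[ v < n ] (deg G v C 2)
  lineEdges≡ = sum-allFin (λ v → deg G v C 2)

  private
    forward : Fin n → Fin n → ℕ
    forward i j = 𝟙 (adj G i j ∧ i ≺ j)

    edges≡ : edges G ≡ ∑[ i < n ] ∑[ j < n ] forward i j
    edges≡ = trans (sum-allFin (λ i → count (λ j → adj G i j ∧ i ≺ j)))
                   (sum-cong-≗ (λ i → count≡card (λ j → adj G i j ∧ i ≺ j)))

    adj-split : ∀ i j → 𝟙 (adj G i j) ≡ forward i j + forward j i
    adj-split i j with adj G i j in ij | adj G j i in ji
    ... | false | false = refl
    ... | true  | true  = sym (≺-trichotomy (adj⇒≢ ij))
    ... | true  | false with () ← trans (sym (adj-flip ij)) ji
    ... | false | true  with () ← trans (sym (adj-flip ji)) ij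

  handshake : ∑[ v < n ] deg G v ≡ edges G + edges G
  handshake = begin
    ∑[ i < n ] deg G i                                                     ≡⟨ sum-cong-≗ (λ i → trans (deg≡card i) (sum-cong-≗ (adj-split i))) ⟩
    ∑[ i < n ] ∑[ j < n ] (forward i j + forward j i)                       ≡⟨ sum-cong-≗ (λ i → ∑-distrib-+ (forward i) (λ j → forward j i)) ⟩
    ∑[ i < n ] (∑[ j < n ] forward i j + ∑[ j < n ] forward j i)            ≡⟨ ∑-distrib-+ (λ i → ∑[ j < n ] forward i j) (λ i → ∑[ j < n ] forward j i) ⟩
    ∑[ i < n ] ∑[ j < n ] forward i j + ∑[ i < n ] ∑[ j < n ] forward j i   ≡⟨ cong (∑[ i < n ] ∑[ j < n ] forward i j +_) (∑-comm (λ i j → forward j i)) ⟩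
    ∑[ i < n ] ∑[ j < n ] forward i j + ∑[ i < n ] ∑[ j < n ] forward i j   ≡⟨ sym (cong₂ _+_ edges≡ edges≡) ⟩
    edges G + edges G                                                      ∎
    where open ≡-Reasoning

+-double-cancel-≤ : ∀ {a b} → a + a ≤ b + b → a ≤ b
+-double-cancel-≤ {a} {b} a+a≤b+b with a ≤? b
... | yes a≤b = a≤b
... | no  a≰b = ⊥-elim (<⇒≱ (+-mono-< (≰⇒> a≰b) (≰⇒> a≰b)) a+a≤b+b)

+-double-injective : ∀ {a b} → a + a ≡ b + b → a ≡ b
+-double-injective eq = ≤-antisym (+-double-cancel-≤ (≤-reflexive eq)) (+-double-cancel-≤ (≤-reflexive (sym eq)))

C2-suc : ∀ n → suc n C 2 ≡ n + n C 2
C2-suc n = trans (sym (nCk+nC[k+1]≡[n+1]C[k+1] n 1)) (cong (_+ n C 2) (nC1≡n n))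

C2-double : ∀ n → n C 2 + n C 2 + n ≡ n * n
C2-double zero    = refl
C2-double (suc n) = begin
  suc n C 2 + suc n C 2 + suc n                ≡⟨ cong (λ c → c + c + suc n) (C2-suc n) ⟩
  (n + n C 2) + (n + n C 2) + suc n            ≡⟨ shuffle n (n C 2) ⟩
  (n C 2 + n C 2 + n) + (n + n + 1)            ≡⟨ cong (_+ (n + n + 1)) (C2-double n) ⟩
  n * n + (n + n + 1)                          ≡⟨ square-suc n ⟩
  suc n * suc n                                ∎
  where
  open ≡-Reasoning
  shuffle : ∀ n c → (n + c) + (n + c) + suc n ≡ (c + c + n) + (n + n + 1)
  shuffle = solve-∀
  square-suc : ∀ n → n * n + (n + n + 1) ≡ suc n * suc n
  square-suc = solve-∀

module _ {n : ℕ} (H : Graph n) {t : ℕ} (edges≡t : edges H ≡ t) where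

  ∑deg≡ : ∑[ v < n ] deg H v ≡ t + t
  ∑deg≡ = trans (handshake H) (cong₂ _+_ edges≡t edges≡t)

  private
    δ : Fin n → Fin n → ℕ
    δ a b = 𝟙 (does (a ≟ b))

    -- A vertex y ∉ {w, x} has at least 𝟙 (w ~ y) + 𝟙 (x ~ y) neighbours, while w and x see each other;
    -- summed over y this gives 2 (deg w + deg x) ≤ 2 t + 2.
    edge-local : ∀ {w x} → adj H w x ≡ true → ∀ y →
      𝟙 (adj H w y) + 𝟙 (adj H x y) + δ w y * deg H w + δ x y * deg H x ≤ deg H y + δ w y + δ x y
    edge-local {w} {x} wx y with w ≟ y | x ≟ y
    ... | yes refl | yes refl = ⊥-elim (adj⇒≢ H wx refl)
    ... | yes refl | no _ rewrite adj-irrefl H w | adj-flip H wx = ≤-reflexive (arith (deg H w))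
      where arith : ∀ d → 0 + 1 + (d + 0) + 0 ≡ d + 1 + 0
            arith = solve-∀
    ... | no _ | yes refl rewrite adj-irrefl H x | wx = ≤-reflexive (arith (deg H x))
      where arith : ∀ d → 1 + 0 + 0 + (d + 0) ≡ d + 0 + 1
            arith = solve-∀
    ... | no _ | no _ = begin
      𝟙 (adj H w y) + 𝟙 (adj H x y) + 0 + 0   ≡⟨ trans (+-identityʳ _) (+-identityʳ _) ⟩
      𝟙 (adj H w y) + 𝟙 (adj H x y)           ≡⟨ cong₂ (λ a b → 𝟙 a + 𝟙 b) (adj-sym H w y) (adj-sym H x y) ⟩
      𝟙 (adj H y w) + 𝟙 (adj H y x)           ≤⟨ 𝟙+𝟙≤card (adj H y) (λ w≡x → adj⇒≢ H wx w≡x) ⟩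
      card (adj H y)                          ≡⟨ sym (trans (+-identityʳ _) (trans (+-identityʳ _) (deg≡card H y))) ⟩
      deg H y + 0 + 0                         ∎
      where open ≤-Reasoning

    sum-δ-weighted : ∀ (f : Fin n → ℕ) a c → ∑[ y < n ] (f y + δ a y * c) ≡ sum f + c
    sum-δ-weighted f a c = trans (∑-distrib-+ f (λ y → δ a y * c)) (cong (sum f +_) (sum-δ a (λ _ → c)))

    ∑-edge-local-lhs : ∀ w x →
      ∑[ y < n ] (𝟙 (adj H w y) + 𝟙 (adj H x y) + δ w y * deg H w + δ x y * deg H x)
        ≡ (deg H w + deg H x) + (deg H w + deg H x)
    ∑-edge-local-lhs w x = begin
      ∑[ y < n ] (𝟙 (adj H w y) + 𝟙 (adj H x y) + δ w y * deg H w + δ x y * deg H x)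
        ≡⟨ sum-δ-weighted _ x (deg H x) ⟩
      ∑[ y < n ] (𝟙 (adj H w y) + 𝟙 (adj H x y) + δ w y * deg H w) + deg H x
        ≡⟨ cong (_+ deg H x) (sum-δ-weighted _ w (deg H w)) ⟩
      ∑[ y < n ] (𝟙 (adj H w y) + 𝟙 (adj H x y)) + deg H w + deg H x
        ≡⟨ cong (λ s → s + deg H w + deg H x) (∑-distrib-+ (λ y → 𝟙 (adj H w y)) (λ y → 𝟙 (adj H x y))) ⟩
      card (adj H w) + card (adj H x) + deg H w + deg H x
        ≡⟨ cong (λ s → s + deg H w + deg H x) (cong₂ _+_ (deg≡card H w) (deg≡card H x)) ⟨
      deg H w + deg H x + deg H w + deg H x
        ≡⟨ +-assoc (deg H w + deg H x) (deg H w) (deg H x) ⟩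
      (deg H w + deg H x) + (deg H w + deg H x)
        ∎
      where open ≡-Reasoning

    ∑-edge-local-rhs : ∀ w x → ∑[ y < n ] (deg H y + δ w y + δ x y) ≡ suc t + suc t
    ∑-edge-local-rhs w x = begin
      ∑[ y < n ] (deg H y + δ w y + δ x y)                  ≡⟨ ∑-distrib-+ (λ y → deg H y + δ w y) (δ x) ⟩
      ∑[ y < n ] (deg H y + δ w y) + ∑[ y < n ] δ x y       ≡⟨ cong (_+ sum (δ x)) (∑-distrib-+ (deg H) (δ w)) ⟩
      ∑[ y < n ] deg H y + ∑[ y < n ] δ w y + ∑[ y < n ] δ x y ≡⟨ cong₂ _+_ (cong₂ _+_ ∑deg≡ (∑δ w)) (∑δ x) ⟩
      t + t + 1 + 1                                         ≡⟨ arith t ⟩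
      suc t + suc t                                         ∎
      where
      open ≡-Reasoning
      ∑δ : ∀ a → ∑[ y < n ] δ a y ≡ 1
      ∑δ a = trans (sum-cong-≗ (λ y → sym (*-identityʳ (δ a y)))) (sum-δ a (λ _ → 1))
      arith : ∀ t → t + t + 1 + 1 ≡ suc t + suc t
      arith = solve-∀

  deg-edge-≤ : ∀ {w x} → adj H w x ≡ true → deg H w + deg H x ≤ suc t
  deg-edge-≤ {w} {x} wx = +-double-cancel-≤ (begin
    (deg H w + deg H x) + (deg H w + deg H x)   ≡⟨ ∑-edge-local-lhs w x ⟨
    _                                           ≤⟨ sum-mono-≤ (edge-local wx) ⟩
    ∑[ y < n ] (deg H y + δ w y + δ x y)        ≡⟨ ∑-edge-local-rhs w x ⟩
    suc t + suc t                               ∎)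
    where open ≤-Reasoning

  deg-edge-tight : ∀ {w x} → adj H w x ≡ true → deg H w + deg H x ≡ suc t →
    ∀ {y} → w ≢ y → x ≢ y → deg H y ≡ 𝟙 (adj H w y) + 𝟙 (adj H x y)
  deg-edge-tight {w} {x} wx tight {y} w≢y x≢y = tight-at y w≢y x≢y (sum-mono-≤-≡ (edge-local wx) sums-equal y)
    where
    sums-equal : _ ≡ _
    sums-equal = trans (∑-edge-local-lhs w x) (trans (cong₂ _+_ tight tight) (sym (∑-edge-local-rhs w x)))
    tight-at : ∀ y → w ≢ y → x ≢ y →
      𝟙 (adj H w y) + 𝟙 (adj H x y) + δ w y * deg H w + δ x y * deg H x ≡ deg H y + δ w y + δ x y →
      deg H y ≡ 𝟙 (adj H w y) + 𝟙 (adj H x y)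
    tight-at y w≢y x≢y eq with w ≟ y | x ≟ y
    ... | yes w≡y | _ = ⊥-elim (w≢y w≡y)
    ... | no _ | yes x≡y = ⊥-elim (x≢y x≡y)
    ... | no _ | no _ = sym (+-cancelʳ-≡ 0 _ _ (+-cancelʳ-≡ 0 _ _ eq))

  private
    ∑𝟙adj* : ∀ w c → ∑[ x < n ] (𝟙 (adj H w x) * c) ≡ deg H w * c
    ∑𝟙adj* w c = trans (sym (*-distribʳ-sum c (λ x → 𝟙 (adj H w x)))) (cong (_* c) (sym (deg≡card H w)))

    edge-weight edge-bound : Fin n → Fin n → ℕ
    edge-weight w x = 𝟙 (adj H w x) * (deg H w + deg H x)
    edge-bound  w x = 𝟙 (adj H w x) * suc t

    edge-weight≤bound : ∀ w x → edge-weight w x ≤ edge-bound w x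
    edge-weight≤bound w x with adj H w x in wx
    ... | true  = *-monoʳ-≤ 1 (deg-edge-≤ wx)
    ... | false = z≤n

    ∑deg² : ℕ
    ∑deg² = ∑[ v < n ] (deg H v * deg H v)

    ∑edge-weight : ∑[ w < n ] ∑[ x < n ] edge-weight w x ≡ ∑deg² + ∑deg²
    ∑edge-weight = begin
      ∑[ w < n ] ∑[ x < n ] edge-weight w x
        ≡⟨ sum-cong-≗ (λ w → trans (sum-cong-≗ (λ x → *-distribˡ-+ (𝟙 (adj H w x)) (deg H w) (deg H x)))
                                   (∑-distrib-+ (λ x → 𝟙 (adj H w x) * deg H w) (λ x → 𝟙 (adj H w x) * deg H x))) ⟩
      ∑[ w < n ] (∑[ x < n ] (𝟙 (adj H w x) * deg H w) + ∑[ x < n ] (𝟙 (adj H w x) * deg H x))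
        ≡⟨ ∑-distrib-+ (λ w → ∑[ x < n ] (𝟙 (adj H w x) * deg H w)) (λ w → ∑[ x < n ] (𝟙 (adj H w x) * deg H x)) ⟩
      ∑[ w < n ] ∑[ x < n ] (𝟙 (adj H w x) * deg H w) + ∑[ w < n ] ∑[ x < n ] (𝟙 (adj H w x) * deg H x)
        ≡⟨ cong₂ _+_ (sum-cong-≗ (λ w → ∑𝟙adj* w (deg H w))) (∑-comm (λ w x → 𝟙 (adj H w x) * deg H x)) ⟩
      ∑deg² + ∑[ x < n ] ∑[ w < n ] (𝟙 (adj H w x) * deg H x)
        ≡⟨ cong (∑deg² +_) (sum-cong-≗ (λ x → trans (sum-cong-≗ (λ w → cong (λ b → 𝟙 b * deg H x) (adj-sym H w x)))
                                                     (∑𝟙adj* x (deg H x)))) ⟩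
      ∑deg² + ∑deg²
        ∎
      where open ≡-Reasoning

    ∑edge-bound : ∑[ w < n ] ∑[ x < n ] edge-bound w x ≡ t * suc t + t * suc t
    ∑edge-bound = trans (sum-cong-≗ (λ w → ∑𝟙adj* w (suc t)))
      (trans (sym (*-distribʳ-sum (suc t) (deg H))) (trans (cong (_* suc t) ∑deg≡) (*-distribʳ-+ (suc t) t t)))

    ∑deg²-≤ : ∑deg² ≤ t * suc t
    ∑deg²-≤ = +-double-cancel-≤ (begin
      ∑deg² + ∑deg²                          ≡⟨ sym ∑edge-weight ⟩
      ∑[ w < n ] ∑[ x < n ] edge-weight w x  ≤⟨ sum-mono-≤ (λ w → sum-mono-≤ (edge-weight≤bound w)) ⟩
      ∑[ w < n ] ∑[ x < n ] edge-bound w x   ≡⟨ ∑edge-bound ⟩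
      t * suc t + t * suc t                  ∎)
      where open ≤-Reasoning

    ∑deg²-tight : ∑deg² ≡ t * suc t → ∀ {w x} → adj H w x ≡ true → deg H w + deg H x ≡ suc t
    ∑deg²-tight eq {w} {x} wx = *-cancelˡ-≡ _ _ 1 (subst (λ b → 𝟙 b * (deg H w + deg H x) ≡ 𝟙 b * suc t) wx weight≡bound)
      where
      outer : ∀ w → ∑[ x < n ] edge-weight w x ≡ ∑[ x < n ] edge-bound w x
      outer = sum-mono-≤-≡ (λ w → sum-mono-≤ (edge-weight≤bound w))
                (trans ∑edge-weight (trans (cong₂ _+_ eq eq) (sym ∑edge-bound)))
      weight≡bound : edge-weight w x ≡ edge-bound w x
      weight≡bound = sum-mono-≤-≡ (edge-weight≤bound w) (outer w) x

    ∑deg²≡ : ∑deg² ≡ ∑[ v < n ] (deg H v C 2) + ∑[ v < n ] (deg H v C 2) + (t + t)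
    ∑deg²≡ = trans (sym (sum-cong-≗ (λ v → C2-double (deg H v))))
      (trans (∑-distrib-+ (λ v → deg H v C 2 + deg H v C 2) (deg H))
        (cong₂ _+_ (∑-distrib-+ (λ v → deg H v C 2) (λ v → deg H v C 2)) ∑deg≡))

    t*suc-t≡ : t * suc t ≡ t C 2 + t C 2 + (t + t)
    t*suc-t≡ = trans (*-suc t t) (trans (cong (t +_) (sym (C2-double t))) (arith (t C 2) t))
      where arith : ∀ c t → t + (c + c + t) ≡ c + c + (t + t)
            arith = solve-∀

  ∑degC2-≤ : ∑[ v < n ] (deg H v C 2) ≤ t C 2
  ∑degC2-≤ = +-double-cancel-≤ (+-cancelʳ-≤ (t + t) _ _
    (≤-trans (≤-reflexive (sym ∑deg²≡)) (≤-trans ∑deg²-≤ (≤-reflexive t*suc-t≡))))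

  ∑degC2-tight : ∑[ v < n ] (deg H v C 2) ≡ t C 2 → ∀ {w x} → adj H w x ≡ true → deg H w + deg H x ≡ suc t
  ∑degC2-tight eq = ∑deg²-tight (trans ∑deg²≡ (trans (cong (λ c → c + c + (t + t)) eq) (sym t*suc-t≡)))

data TightShape {n : ℕ} (H : Graph n) (t : ℕ) : Set where
  star     : ∀ v → deg H v ≡ t → (∀ {a b} → adj H a b ≡ true → a ≡ v ⊎ b ≡ v) → TightShape H t
  triangle : ∀ w x y → t ≡ 3 → adj H w x ≡ true → adj H x y ≡ true → adj H w y ≡ true →
             (∀ c → 1 ≤ deg H c → c ≡ w ⊎ c ≡ x ⊎ c ≡ y) → TightShape H t

module _ {n : ℕ} (H : Graph n) {t : ℕ} (edges≡t : edges H ≡ t) (1≤t : 1 ≤ t)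
         (tight : ∀ {w x} → adj H w x ≡ true → deg H w + deg H x ≡ suc t) where

  private
    neighbourhood : ∀ {w x} → adj H w x ≡ true → ∀ {y} → w ≢ y → x ≢ y → deg H y ≡ 𝟙 (adj H w y) + 𝟙 (adj H x y)
    neighbourhood wx = deg-edge-tight H edges≡t wx (tight wx)

    covers : ∀ {w x} → adj H w x ≡ true → ∀ {y c} → w ≢ y → x ≢ y → adj H y c ≡ true → c ≡ w ⊎ c ≡ x
    covers {w} {x} wx {y} {c} w≢y x≢y yc with w ≟ c | x ≟ c
    ... | yes w≡c | _       = inj₁ (sym w≡c)
    ... | no _    | yes x≡c = inj₂ (sym x≡c)
    ... | no w≢c  | no x≢c  = ⊥-elim (<-irrefl refl (begin-strict
      deg H y                                              ≡⟨ neighbourhood wx w≢y x≢y ⟩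
      𝟙 (adj H w y) + 𝟙 (adj H x y)                        ≡⟨ cong₂ (λ a b → 𝟙 a + 𝟙 b) (adj-sym H w y) (adj-sym H x y) ⟩
      𝟙 (adj H y w) + 𝟙 (adj H y x)                        <⟨ m<m+n _ (≤-reflexive (cong 𝟙 (sym yc))) ⟩
      𝟙 (adj H y w) + 𝟙 (adj H y x) + 𝟙 (adj H y c)        ≤⟨ 𝟙+𝟙+𝟙≤card (adj H y) (adj⇒≢ H wx) w≢c x≢c ⟩
      card (adj H y)                                       ≡⟨ sym (deg≡card H y) ⟩
      deg H y                                              ∎))
      where open ≤-Reasoning

    partner-of-leaf : ∀ {w y} → adj H w y ≡ true → deg H y ≡ 1 → deg H w ≡ t
    partner-of-leaf {w} wy y-leaf = +-cancelʳ-≡ 1 (deg H w) t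
      (trans (cong (deg H w +_) (sym y-leaf)) (trans (tight wy) (+-comm 1 t)))

  star-shape : ∀ {v} → deg H v ≡ t → TightShape H t
  star-shape {v} v-hub = star v v-hub all-at-v
    where
    v-edge : ∃ λ z → adj H v z ≡ true
    v-edge = neighbour H (≤-trans 1≤t (≤-reflexive (sym v-hub)))
    z : Fin n
    z = proj₁ v-edge
    vz : adj H v z ≡ true
    vz = proj₂ v-edge
    z-leaf : deg H z ≡ 1
    z-leaf = +-cancelˡ-≡ t (deg H z) 1 (trans (cong (_+ deg H z) (sym v-hub)) (trans (tight vz) (+-comm 1 t)))
    only-v : ∀ {b} → adj H z b ≡ true → b ≡ v
    only-v {b} zb with v ≟ b
    ... | yes v≡b = sym v≡b
    ... | no v≢b  = ⊥-elim (<⇒≢ (deg-≥2 H v≢b (adj-flip H vz) zb) (sym z-leaf))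
    all-at-v : ∀ {a b} → adj H a b ≡ true → a ≡ v ⊎ b ≡ v
    all-at-v {a} {b} ab with a ≟ v | b ≟ v
    ... | yes a≡v | _       = inj₁ a≡v
    ... | no _    | yes b≡v = inj₂ b≡v
    ... | no a≢v  | no b≢v  with z ≟ a
    ...   | yes refl = ⊥-elim (b≢v (only-v ab))
    ...   | no z≢a with covers vz (λ v≡a → a≢v (sym v≡a)) z≢a ab
    ...     | inj₁ b≡v = ⊥-elim (b≢v b≡v)
    ...     | inj₂ refl = ⊥-elim (a≢v (only-v (adj-flip H ab)))

  private
    -- a second neighbour y of w, if not adjacent to x, would be a leaf and force deg w = t
    closes-triangle : ∀ {w x y} → adj H w x ≡ true → adj H w y ≡ true → x ≢ y → deg H w ≢ t →
                      adj H x y ≡ true × deg H y ≡ 2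
    closes-triangle {w} {x} {y} wx wy x≢y w≢hub with adj H x y in xy
    ... | true  = refl , trans (neighbourhood wx (adj⇒≢ H wy) x≢y) (cong₂ (λ a b → 𝟙 a + 𝟙 b) wy xy)
    ... | false = ⊥-elim (w≢hub (partner-of-leaf wy
                    (trans (neighbourhood wx (adj⇒≢ H wy) x≢y) (cong₂ (λ a b → 𝟙 a + 𝟙 b) wy xy))))

    isolated-from-triangle : ∀ {w x y c} → adj H w x ≡ true → adj H w y ≡ true → adj H x y ≡ true →
      deg H w ≡ 2 → deg H x ≡ 2 → w ≢ c → x ≢ c → y ≢ c → deg H c ≡ 0
    isolated-from-triangle {w} {x} {y} {c} wx wy xy w-two x-two w≢c x≢c y≢c
      with adj H w c in wc | adj H x c in xc
    ... | true  | _    = ⊥-elim (<⇒≢ (deg-≥3 H (adj⇒≢ H xy) x≢c y≢c wx wy wc) (sym w-two))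
    ... | false | true = ⊥-elim (<⇒≢ (deg-≥3 H (adj⇒≢ H wy) w≢c y≢c (adj-flip H wx) xy xc) (sym x-two))
    ... | false | false = trans (neighbourhood wx w≢c x≢c) (cong₂ (λ a b → 𝟙 a + 𝟙 b) wc xc)

    degree-at-most-two : ∀ {w x y} → adj H w x ≡ true → adj H w y ≡ true → adj H x y ≡ true →
                         deg H x ≡ 2 → deg H w ≢ t → deg H w ≤ 2
    degree-at-most-two {w} {x} {y} wx wy xy x-two w≢hub with deg H w ≤? 2
    ... | yes w≤2 = w≤2
    ... | no  w≰2 with card-≥3⇒other (adj H w) x y (≤-trans (≰⇒> w≰2) (≤-reflexive (deg≡card H w)))
    ...   | z , wz , x≢z , y≢z = ⊥-elim (<⇒≢
            (deg-≥3 H (adj⇒≢ H wy) (adj⇒≢ H wz) y≢z (adj-flip H wx) xy (proj₁ (closes-triangle wx wz x≢z w≢hub)))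
            (sym x-two))

    triangle-spans : ∀ {w x y} → adj H w x ≡ true → adj H w y ≡ true → adj H x y ≡ true →
                     deg H w ≡ 2 → deg H x ≡ 2 → ∀ c → 1 ≤ deg H c → c ≡ w ⊎ c ≡ x ⊎ c ≡ y
    triangle-spans {w} {x} {y} wx wy xy w-two x-two c c-pos with w ≟ c | x ≟ c | y ≟ c
    ... | yes w≡c | _       | _       = inj₁ (sym w≡c)
    ... | no _    | yes x≡c | _       = inj₂ (inj₁ (sym x≡c))
    ... | no _    | no _    | yes y≡c = inj₂ (inj₂ (sym y≡c))
    ... | no w≢c  | no x≢c  | no y≢c  =
          ⊥-elim (<⇒≢ c-pos (sym (isolated-from-triangle wx wy xy w-two x-two w≢c x≢c y≢c)))

  triangle-shape : ∀ {w x} → adj H w x ≡ true → deg H w ≢ t → deg H x ≢ t → TightShape H t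
  triangle-shape {w} {x} wx w≢hub x≢hub = triangle w x y t≡3 wx xy wy (triangle-spans wx wy xy w-two x-two)
    where
    x<t : deg H x < t
    x<t = ≤∧≢⇒< (≤-pred (≤-trans (+-monoˡ-≤ (deg H x) (deg-pos H wx)) (≤-reflexive (tight wx)))) x≢hub
    w≥2 : 2 ≤ deg H w
    w≥2 = +-cancelʳ-≤ (deg H x) 2 (deg H w) (≤-trans (s≤s x<t) (≤-reflexive (sym (tight wx))))
    second-neighbour : ∃ λ y → adj H w y ≡ true × x ≢ y
    second-neighbour = card-≥2⇒other (adj H w) x (≤-trans w≥2 (≤-reflexive (deg≡card H w)))
    y : Fin n
    y = proj₁ second-neighbour
    wy : adj H w y ≡ true
    wy = proj₁ (proj₂ second-neighbour)
    xy : adj H x y ≡ true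
    xy = proj₁ (closes-triangle wx wy (proj₂ (proj₂ second-neighbour)) w≢hub)
    y-two : deg H y ≡ 2
    y-two = proj₂ (closes-triangle wx wy (proj₂ (proj₂ second-neighbour)) w≢hub)
    x-two : deg H x ≡ 2
    x-two = +-cancelˡ-≡ (deg H w) (deg H x) 2 (trans (tight wx) (trans (sym (tight wy)) (cong (deg H w +_) y-two)))
    w-two : deg H w ≡ 2
    w-two = ≤-antisym (degree-at-most-two wx wy xy x-two w≢hub) w≥2
    t≡3 : t ≡ 3
    t≡3 = suc-injective (trans (sym (tight wy)) (cong₂ _+_ w-two y-two))

  tight-shape : TightShape H t
  tight-shape with sum-positive (deg H) (≤-trans 1≤t (≤-trans (m≤m+n t t) (≤-reflexive (sym (∑deg≡ H edges≡t)))))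
  ... | w , w-pos with neighbour H w-pos
  ... | x , wx with deg H w ≟ℕ t | deg H x ≟ℕ t
  ... | yes w-hub | _ = star-shape w-hub
  ... | no _ | yes x-hub = star-shape x-hub
  ... | no w≢hub | no x≢hub = triangle-shape wx w≢hub x≢hub

-- Deleting the edges at u; u stays as an isolated vertex, so G ⊖ u has the same vertex type.
_⊖_ : ∀ {n} → Graph n → Fin n → Graph n
adj (G ⊖ u) i j = not (does (u ≟ i)) ∧ (adj G i ∖ u) j
adj-sym (G ⊖ u) i j with u ≟ i | u ≟ j
... | yes _ | yes _ = refl
... | yes _ | no _  = refl
... | no _  | yes _ = refl
... | no _  | no _  = adj-sym G i j
adj-irrefl (G ⊖ u) i with u ≟ i
... | yes _ = refl
... | no _  = adj-irrefl G i

module _ {n : ℕ} (G : Graph n) (u : Fin n) where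

  ⊖-adj⁻ : ∀ {i j} → adj (G ⊖ u) i j ≡ true → adj G i j ≡ true × u ≢ i × u ≢ j
  ⊖-adj⁻ {i} {j} ij with u ≟ i | u ≟ j
  ... | no u≢i | no u≢j = ij , u≢i , u≢j

  ⊖-adj⁺ : ∀ {i j} → adj G i j ≡ true → u ≢ i → u ≢ j → adj (G ⊖ u) i j ≡ true
  ⊖-adj⁺ {i} {j} ij u≢i u≢j with u ≟ i | u ≟ j
  ... | yes u≡i | _       = ⊥-elim (u≢i u≡i)
  ... | no _    | yes u≡j = ⊥-elim (u≢j u≡j)
  ... | no _    | no _    = ij

  private
    h : Fin n → ℕ
    h = deg (G ⊖ u)

  deg-⊖-centre : deg (G ⊖ u) u ≡ 0
  deg-⊖-centre = trans (deg≡card (G ⊖ u) u) (trans (sum-cong-≗ isolated) (sum-zero {n}))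
    where
    isolated : ∀ j → 𝟙 (adj (G ⊖ u) u j) ≡ 0
    isolated j with u ≟ u
    ... | yes _   = refl
    ... | no u≢u  = ⊥-elim (u≢u refl)

  deg-⊖-off : ∀ {w} → u ≢ w → deg G w ≡ 𝟙 (adj G u w) + deg (G ⊖ u) w
  deg-⊖-off {w} u≢w = trans (deg≡card G w) (trans (card-∖ (adj G w) u)
    (cong₂ _+_ (cong 𝟙 (adj-sym G w u)) (sym (trans (deg≡card (G ⊖ u) w) (sum-cong-≗ off-u)))))
    where
    off-u : ∀ j → 𝟙 (adj (G ⊖ u) w j) ≡ 𝟙 ((adj G w ∖ u) j)
    off-u j with u ≟ w
    ... | yes u≡w = ⊥-elim (u≢w u≡w)
    ... | no _    = refl

  edges-⊖ : edges G ≡ deg G u + edges (G ⊖ u)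
  edges-⊖ = +-double-injective (begin
    edges G + edges G                                           ≡⟨ handshake G ⟨
    ∑[ w < n ] deg G w                                          ≡⟨ trans (cong (sum (deg G) +_) (cong₂ (λ b k → 𝟙 b + k) (adj-irrefl G u) deg-⊖-centre)) (+-identityʳ (sum (deg G))) ⟨
    ∑[ w < n ] deg G w + (𝟙 (adj G u u) + h u)                  ≡⟨ sum-update u deg-⊖-off ⟩
    ∑[ w < n ] (𝟙 (adj G u w) + h w) + deg G u                  ≡⟨ cong (_+ deg G u) (∑-distrib-+ (λ w → 𝟙 (adj G u w)) h) ⟩
    card (adj G u) + ∑[ w < n ] h w + deg G u                   ≡⟨ cong₂ (λ d e → d + e + deg G u) (sym (deg≡card G u)) (handshake (G ⊖ u)) ⟩
    deg G u + (edges (G ⊖ u) + edges (G ⊖ u)) + deg G u         ≡⟨ arith (deg G u) (edges (G ⊖ u)) ⟩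
    (deg G u + edges (G ⊖ u)) + (deg G u + edges (G ⊖ u))       ∎)
    where
    open ≡-Reasoning
    arith : ∀ d e → d + (e + e) + d ≡ (d + e) + (d + e)
    arith = solve-∀

  lineEdges-⊖ : lineEdges G ≡ deg G u C 2 +
    (∑[ w < n ] (deg (G ⊖ u) w C 2) + ∑[ w < n ] (𝟙 (adj G u w) * deg (G ⊖ u) w))
  lineEdges-⊖ = begin
    lineEdges G                                                                ≡⟨ lineEdges≡ G ⟩
    ∑[ w < n ] (deg G w C 2)                                                   ≡⟨ trans (cong (sum (λ w → deg G w C 2) +_) at-u) (+-identityʳ _) ⟨
    ∑[ w < n ] (deg G w C 2) + (h u C 2 + 𝟙 (adj G u u) * h u)                 ≡⟨ sum-update u pointwise ⟩
    ∑[ w < n ] (h w C 2 + 𝟙 (adj G u w) * h w) + deg G u C 2                  ≡⟨ +-comm _ (deg G u C 2) ⟩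
    deg G u C 2 + ∑[ w < n ] (h w C 2 + 𝟙 (adj G u w) * h w)                  ≡⟨ cong (deg G u C 2 +_) (∑-distrib-+ (λ w → h w C 2) (λ w → 𝟙 (adj G u w) * h w)) ⟩
    deg G u C 2 + (∑[ w < n ] (h w C 2) + ∑[ w < n ] (𝟙 (adj G u w) * h w))   ∎
    where
    open ≡-Reasoning
    C2-𝟙+ : ∀ b k → (𝟙 b + k) C 2 ≡ k C 2 + 𝟙 b * k
    C2-𝟙+ true  k = trans (C2-suc k) (trans (+-comm k (k C 2)) (cong (k C 2 +_) (sym (+-identityʳ k))))
    C2-𝟙+ false k = sym (+-identityʳ (k C 2))
    at-u : h u C 2 + 𝟙 (adj G u u) * h u ≡ 0
    at-u = trans (cong (λ k → k C 2 + 𝟙 (adj G u u) * k) deg-⊖-centre) (*-zeroʳ (𝟙 (adj G u u)))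
    pointwise : ∀ {w} → u ≢ w → deg G w C 2 ≡ h w C 2 + 𝟙 (adj G u w) * h w
    pointwise {w} u≢w = trans (cong (_C 2) (deg-⊖-off u≢w)) (C2-𝟙+ (adj G u w) (h w))

emptyGraph : ∀ n → Graph n
adj        (emptyGraph n) _ _ = false
adj-sym    (emptyGraph n) _ _ = refl
adj-irrefl (emptyGraph n) _   = refl

addVertex : ∀ {n} → (Fin n → Bool) → Graph n → Graph (suc n)
adj (addVertex s G) zero    zero    = false
adj (addVertex s G) zero    (suc j) = s j
adj (addVertex s G) (suc i) zero    = s i
adj (addVertex s G) (suc i) (suc j) = adj G i j
adj-sym (addVertex s G) zero    zero    = refl
adj-sym (addVertex s G) zero    (suc j) = refl
adj-sym (addVertex s G) (suc i) zero    = refl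
adj-sym (addVertex s G) (suc i) (suc j) = adj-sym G i j
adj-irrefl (addVertex s G) zero    = refl
adj-irrefl (addVertex s G) (suc i) = adj-irrefl G i

deg-emptyGraph : ∀ {n} (i : Fin n) → deg (emptyGraph n) i ≡ 0
deg-emptyGraph {n} i = trans (deg≡card (emptyGraph n) i) (sum-zero {n})

deg-addVertex-new : ∀ {n} (s : Fin n → Bool) (G : Graph n) → deg (addVertex s G) zero ≡ card s
deg-addVertex-new s G = deg≡card (addVertex s G) zero

deg-addVertex-old : ∀ {n} (s : Fin n → Bool) (G : Graph n) i → deg (addVertex s G) (suc i) ≡ 𝟙 (s i) + deg G i
deg-addVertex-old s G i = trans (deg≡card (addVertex s G) (suc i)) (cong (𝟙 (s i) +_) (sym (deg≡card G i)))

card-all : ∀ n → card {n} (λ _ → true) ≡ n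
card-all zero    = refl
card-all (suc n) = cong suc (card-all n)

card-<ᵇ : ∀ t k → card {t + k} (λ i → toℕ i <ᵇ t) ≡ t
card-<ᵇ zero    k = sum-zero {k}
card-<ᵇ (suc t) k = cong suc (card-<ᵇ t k)

-- Q(N, t) for N = 2t + k + 1: vertex 0 is u, joined to all others; vertex 1 is v, also joined to the next t vertices.
qGraph : ∀ t k → Graph (2 + (t + k))
qGraph t k = addVertex (λ _ → true) (addVertex (λ i → toℕ i <ᵇ t) (emptyGraph (t + k)))

lineBound : ℕ → ℕ → ℕ
lineBound D t = D C 2 + (t C 2 + (t + t))

lineBound≡ : ∀ D t → lineBound D t ≡ D C 2 + (t + 2) C 2 ∸ 1
lineBound≡ D t = sym (begin
  D C 2 + (t + 2) C 2 ∸ 1                      ≡⟨ cong (λ m → D C 2 + m C 2 ∸ 1) (+-comm t 2) ⟩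
  D C 2 + (2 + t) C 2 ∸ 1                      ≡⟨ cong (λ c → D C 2 + c ∸ 1) (trans (C2-suc (suc t)) (cong (suc t +_) (C2-suc t))) ⟩
  D C 2 + (suc t + (t + t C 2)) ∸ 1            ≡⟨ cong (_∸ 1) (+-suc (D C 2) (t + (t + t C 2))) ⟩
  D C 2 + (t + (t + t C 2))                    ≡⟨ cong (D C 2 +_) (arith t (t C 2)) ⟩
  lineBound D t                                ∎)
  where
  open ≡-Reasoning
  arith : ∀ t c → t + (t + c) ≡ c + (t + t)
  arith = solve-∀

module _ (t k : ℕ) where

  private
    Q : Graph (2 + (t + k))
    Q = qGraph t k

  deg-qGraph-u : deg Q zero ≡ suc (t + k)
  deg-qGraph-u = trans (deg-addVertex-new (λ _ → true) (addVertex (λ i → toℕ i <ᵇ t) (emptyGraph (t + k)))) (card-all (suc (t + k)))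

  deg-qGraph-v : deg Q (suc zero) ≡ suc t
  deg-qGraph-v = trans (deg-addVertex-old (λ _ → true) (addVertex (λ i → toℕ i <ᵇ t) (emptyGraph (t + k))) zero)
    (cong suc (trans (deg-addVertex-new (λ i → toℕ i <ᵇ t) (emptyGraph (t + k))) (card-<ᵇ t k)))

  deg-qGraph-rest : ∀ i → deg Q (suc (suc i)) ≡ suc (𝟙 (toℕ i <ᵇ t))
  deg-qGraph-rest i = trans (deg-addVertex-old (λ _ → true) (addVertex (λ i → toℕ i <ᵇ t) (emptyGraph (t + k))) (suc i))
    (cong suc (trans (deg-addVertex-old (λ i → toℕ i <ᵇ t) (emptyGraph (t + k)) i) (trans (cong (𝟙 (toℕ i <ᵇ t) +_) (deg-emptyGraph i)) (+-identityʳ _))))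

  private
    ∑deg-rest : ∑[ i < t + k ] deg Q (suc (suc i)) ≡ (t + k) + t
    ∑deg-rest = trans (sum-cong-≗ deg-qGraph-rest)
      (trans (∑-distrib-+ {t + k} (λ _ → 1) (λ i → 𝟙 (toℕ i <ᵇ t))) (cong₂ _+_ (card-all (t + k)) (card-<ᵇ t k)))

  edges-qGraph : edges Q ≡ suc (t + t + k)
  edges-qGraph = +-double-injective (begin
    edges Q + edges Q                                                     ≡⟨ sym (handshake Q) ⟩
    deg Q zero + (deg Q (suc zero) + ∑[ i < t + k ] deg Q (suc (suc i)))  ≡⟨ cong₂ (λ a b → a + (b + ∑[ i < t + k ] deg Q (suc (suc i)))) deg-qGraph-u deg-qGraph-v ⟩
    suc (t + k) + (suc t + ∑[ i < t + k ] deg Q (suc (suc i)))            ≡⟨ cong (λ s → suc (t + k) + (suc t + s)) ∑deg-rest ⟩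
    suc (t + k) + (suc t + ((t + k) + t))                                 ≡⟨ arith t k ⟩
    suc (t + t + k) + suc (t + t + k)                                     ∎)
    where
    open ≡-Reasoning
    arith : ∀ t k → suc (t + k) + (suc t + ((t + k) + t)) ≡ suc (t + t + k) + suc (t + t + k)
    arith = solve-∀

  lineEdges-qGraph : lineEdges Q ≡ lineBound (suc (t + k)) t
  lineEdges-qGraph = begin
    lineEdges Q                                                                         ≡⟨ lineEdges≡ Q ⟩
    deg Q zero C 2 + (deg Q (suc zero) C 2 + ∑[ i < t + k ] (deg Q (suc (suc i)) C 2))  ≡⟨ cong₂ (λ a b → a C 2 + (b C 2 + ∑[ i < t + k ] (deg Q (suc (suc i)) C 2))) deg-qGraph-u deg-qGraph-v ⟩
    suc (t + k) C 2 + (suc t C 2 + ∑[ i < t + k ] (deg Q (suc (suc i)) C 2))            ≡⟨ cong₂ (λ c s → suc (t + k) C 2 + (c + s)) (C2-suc t) rest ⟩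
    suc (t + k) C 2 + ((t + t C 2) + t)                                                 ≡⟨ cong (suc (t + k) C 2 +_) (arith t (t C 2)) ⟩
    lineBound (suc (t + k)) t                                                           ∎
    where
    open ≡-Reasoning
    C2-suc-𝟙 : ∀ b → suc (𝟙 b) C 2 ≡ 𝟙 b
    C2-suc-𝟙 true  = refl
    C2-suc-𝟙 false = refl
    rest : ∑[ i < t + k ] (deg Q (suc (suc i)) C 2) ≡ t
    rest = trans (sum-cong-≗ (λ i → trans (cong (_C 2) (deg-qGraph-rest i)) (C2-suc-𝟙 (toℕ i <ᵇ t)))) (card-<ᵇ t k)
    arith : ∀ t c → t + c + t ≡ c + (t + t)
    arith = solve-∀

  qGraph-admissible : 1 ≤ t → Admissible Q (suc (t + t + k)) (suc (t + k))
  qGraph-admissible 1≤t = edges-qGraph , (deg≤ , zero , deg-qGraph-u) , no-isolated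
    where
    deg≤ : ∀ v → deg Q v ≤ suc (t + k)
    deg≤ zero          = ≤-reflexive deg-qGraph-u
    deg≤ (suc zero)    = ≤-trans (≤-reflexive deg-qGraph-v) (s≤s (m≤m+n t k))
    deg≤ (suc (suc i)) = ≤-trans (≤-reflexive (deg-qGraph-rest i)) (s≤s (≤-trans (𝟙≤1 _) (≤-trans 1≤t (m≤m+n t k))))
    no-isolated : NoIsolated Q
    no-isolated zero          = ≤-trans (s≤s z≤n) (≤-reflexive (sym deg-qGraph-u))
    no-isolated (suc zero)    = ≤-trans (s≤s z≤n) (≤-reflexive (sym deg-qGraph-v))
    no-isolated (suc (suc i)) = ≤-trans (s≤s z≤n) (≤-reflexive (sym (deg-qGraph-rest i)))

module _ {n : ℕ} (G : Graph n) (u : Fin n) {t : ℕ} (edges-⊖≡t : edges (G ⊖ u) ≡ t) where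

  private
    h : Fin n → ℕ
    h = deg (G ⊖ u)

    ∑𝟙*h-≤ : ∑[ w < n ] (𝟙 (adj G u w) * h w) ≤ t + t
    ∑𝟙*h-≤ = ≤-trans (sum-mono-≤ (λ w → 𝟙*≤ (adj G u w) (h w))) (≤-reflexive (∑deg≡ (G ⊖ u) edges-⊖≡t))

  lineEdges-≤ : lineEdges G ≤ lineBound (deg G u) t
  lineEdges-≤ = ≤-trans (≤-reflexive (lineEdges-⊖ G u))
    (+-monoʳ-≤ (deg G u C 2) (+-mono-≤ (∑degC2-≤ (G ⊖ u) edges-⊖≡t) ∑𝟙*h-≤))

  module _ (1≤t : 1 ≤ t) (extremal : lineEdges G ≡ lineBound (deg G u) t) where

    private
      both-tight : ∑[ w < n ] (h w C 2) ≡ t C 2 × ∑[ w < n ] (𝟙 (adj G u w) * h w) ≡ t + t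
      both-tight = +-mono-≤-≡ (∑degC2-≤ (G ⊖ u) edges-⊖≡t) ∑𝟙*h-≤
        (+-cancelˡ-≡ (deg G u C 2) _ _ (trans (sym (lineEdges-⊖ G u)) extremal))

      adjacent-to-u : ∀ {w x} → adj (G ⊖ u) w x ≡ true → adj G u w ≡ true
      adjacent-to-u {w} wx = 𝟙*-fixed (deg-pos (G ⊖ u) wx)
        (sum-mono-≤-≡ (λ w → 𝟙*≤ (adj G u w) (h w)) (trans (proj₂ both-tight) (sym (∑deg≡ (G ⊖ u) edges-⊖≡t))) w)

      at-u-or-in-G⊖u : ∀ {a b} → adj G a b ≡ true → (a ≡ u ⊎ b ≡ u) ⊎ adj (G ⊖ u) a b ≡ true
      at-u-or-in-G⊖u {a} {b} ab = cases (u ≟ a) (u ≟ b)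
        where
        cases : Dec (u ≡ a) → Dec (u ≡ b) → (a ≡ u ⊎ b ≡ u) ⊎ adj (G ⊖ u) a b ≡ true
        cases (yes u≡a) _         = inj₁ (inj₁ (sym u≡a))
        cases (no _)    (yes u≡b) = inj₁ (inj₂ (sym u≡b))
        cases (no u≢a)  (no u≢b)  = inj₂ (⊖-adj⁺ G u ab u≢a u≢b)

      second-neighbourhood : ∀ {v w} → adj G u v ≡ true → adj G v w ≡ true → w ≡ u ⊎ adj G u w ≡ true
      second-neighbourhood {v} {w} uv vw = cases (at-u-or-in-G⊖u vw)
        where
        cases : (v ≡ u ⊎ w ≡ u) ⊎ adj (G ⊖ u) v w ≡ true → w ≡ u ⊎ adj G u w ≡ true
        cases (inj₁ (inj₁ v≡u)) = ⊥-elim (adj⇒≢ G uv (sym v≡u))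
        cases (inj₁ (inj₂ w≡u)) = inj₁ w≡u
        cases (inj₂ vw′)        = inj₂ (adjacent-to-u (adj-flip (G ⊖ u) vw′))

      star⇒IsQ : ∀ {N} → deg G u ≡ N ∸ t → ∀ v → deg (G ⊖ u) v ≡ t →
                 (∀ {a b} → adj (G ⊖ u) a b ≡ true → a ≡ v ⊎ b ≡ v) → IsQ G N t
      star⇒IsQ du v v-hub all-at-v =
        u , v , uv , du , deg-v , (λ w → second-neighbourhood uv) , (λ a b ab → map₂ all-at-v (at-u-or-in-G⊖u ab))
        where
        v-edge : ∃ λ x → adj (G ⊖ u) v x ≡ true
        v-edge = neighbour (G ⊖ u) (≤-trans 1≤t (≤-reflexive (sym v-hub)))
        uv : adj G u v ≡ true
        uv = adjacent-to-u (proj₂ v-edge)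
        deg-v : deg G v ≡ t + 1
        deg-v = trans (deg-⊖-off G u (proj₁ (proj₂ (⊖-adj⁻ G u (proj₂ v-edge)))))
                      (trans (cong₂ (λ b k → 𝟙 b + k) uv v-hub) (+-comm 1 t))

      triangle⇒IsQstar : ∀ {N} → deg G u ≡ N ∸ t → ∀ w x y → t ≡ 3 →
        adj (G ⊖ u) w x ≡ true → adj (G ⊖ u) x y ≡ true → adj (G ⊖ u) w y ≡ true →
        (∀ c → 1 ≤ deg (G ⊖ u) c → c ≡ w ⊎ c ≡ x ⊎ c ≡ y) → IsQstar G N
      triangle⇒IsQstar du w x y refl wx xy wy spans =
        u , w , x , y , du , adjacent-to-u wx , adjacent-to-u xy , adjacent-to-u (adj-flip (G ⊖ u) wy) ,
        in-G wx , in-G xy , in-G wy ,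
        λ a b ab → map₂ (λ ab′ → spans a (deg-pos (G ⊖ u) ab′) , spans b (deg-pos (G ⊖ u) (adj-flip (G ⊖ u) ab′)))
                        (at-u-or-in-G⊖u ab)
        where
        in-G : ∀ {a b} → adj (G ⊖ u) a b ≡ true → adj G a b ≡ true
        in-G ab = proj₁ (⊖-adj⁻ G u ab)

    extremal-shape : ∀ {N} → deg G u ≡ N ∸ t → IsQ G N t ⊎ (t ≡ 3 × IsQstar G N)
    extremal-shape {N} du = from-shape (tight-shape (G ⊖ u) edges-⊖≡t 1≤t (∑degC2-tight (G ⊖ u) edges-⊖≡t (proj₁ both-tight)))
      where
      from-shape : TightShape (G ⊖ u) t → IsQ G N t ⊎ (t ≡ 3 × IsQstar G N)
      from-shape (star v v-hub all-at-v)             = inj₁ (star⇒IsQ du v v-hub all-at-v)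
      from-shape (triangle w x y t≡3 wx xy wy spans) = inj₂ (t≡3 , triangle⇒IsQstar du w x y t≡3 wx xy wy spans)

module _ {n : ℕ} (G : Graph n) {N t : ℕ} (t≤N : t ≤ N) where

  admissible-centre : Admissible G N (N ∸ t) → ∃ λ u → deg G u ≡ N ∸ t × edges (G ⊖ u) ≡ t
  admissible-centre (edges≡N , (_ , u , du) , _) = u , du , +-cancelˡ-≡ (N ∸ t) _ _ (begin
    N ∸ t + edges (G ⊖ u)     ≡⟨ cong (_+ edges (G ⊖ u)) (sym du) ⟩
    deg G u + edges (G ⊖ u)   ≡⟨ sym (edges-⊖ G u) ⟩
    edges G                   ≡⟨ edges≡N ⟩
    N                         ≡⟨ sym (m∸n+n≡m t≤N) ⟩
    N ∸ t + t                 ∎)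
    where open ≡-Reasoning

  admissible-lineEdges-≤ : Admissible G N (N ∸ t) → lineEdges G ≤ lineBound (N ∸ t) t
  admissible-lineEdges-≤ adm with admissible-centre adm
  ... | u , du , edges-⊖≡t = subst (λ D → lineEdges G ≤ lineBound D t) du (lineEdges-≤ G u edges-⊖≡t)

excess : ∀ {t N} → 2 * t + 1 ≤ N → ∃ λ k → N ≡ suc (t + t + k)
excess {t} {N} 2t+1≤N = N ∸ (2 * t + 1) , trans (sym (m+[n∸m]≡n 2t+1≤N)) (arith t (N ∸ (2 * t + 1)))
  where
  arith : ∀ t k → 2 * t + 1 + k ≡ suc (t + t + k)
  arith = solve-∀

qGraph-witness : ∀ {t N} → 1 ≤ t → 2 * t + 1 ≤ N →
  Σ ℕ λ m → Σ (Graph m) λ Q → Admissible Q N (N ∸ t) × lineEdges Q ≡ lineBound (N ∸ t) t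
qGraph-witness {t} 1≤t 2t+1≤N with excess {t} 2t+1≤N
... | k , refl = _ , qGraph t k ,
  subst (Admissible (qGraph t k) _) (sym D≡) (qGraph-admissible t k 1≤t) ,
  trans (lineEdges-qGraph t k) (cong (λ D → lineBound D t) (sym D≡))
  where
  D≡ : suc (t + t + k) ∸ t ≡ suc (t + k)
  D≡ = trans (cong (_∸ t) (arith t k)) (m+n∸m≡n t (suc (t + k)))
    where
    arith : ∀ t k → suc (t + t + k) ≡ t + suc (t + k)
    arith = solve-∀

mainTheorem13 : (t N : ℕ) → 1 ≤ t → 2 * t + 1 ≤ N →
    (n : ℕ) (G : Graph n) → Extremal G N (N ∸ t) →
    FValue N (N ∸ t) ((N ∸ t) C 2 + (t + 2) C 2 ∸ 1) ×
    (IsQ G N t ⊎ (t ≡ 3 × IsQstar G N))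
mainTheorem13 t N 1≤t 2t+1≤N n G (G-admissible , G-maximal) =
  let m , Q , Q-admissible , Q-lineEdges = qGraph-witness 1≤t 2t+1≤N
      u , deg-u , edges-⊖≡t = admissible-centre G t≤N G-admissible
      G-lineEdges = ≤-antisym (upper G G-admissible) (subst (_≤ lineEdges G) Q-lineEdges (G-maximal m Q Q-admissible))
  in ((m , Q , Q-admissible , trans Q-lineEdges value≡) ,
      λ _ H H-admissible → subst (lineEdges H ≤_) value≡ (upper H H-admissible)) ,
     extremal-shape G u edges-⊖≡t 1≤t (subst (λ D → lineEdges G ≡ lineBound D t) (sym deg-u) G-lineEdges) deg-u
  where
  t≤N : t ≤ N
  t≤N = ≤-trans (m≤m+n t (t + 0)) (≤-trans (m≤m+n (2 * t) 1) 2t+1≤N)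
  upper : ∀ {m} (H : Graph m) → Admissible H N (N ∸ t) → lineEdges H ≤ lineBound (N ∸ t) t
  upper H = admissible-lineEdges-≤ H t≤N
  value≡ : lineBound (N ∸ t) t ≡ (N ∸ t) C 2 + (t + 2) C 2 ∸ 1
  value≡ = lineBound≡ (N ∸ t) t
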